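{- Let $G$ be a group, $H$ a subgroup of $G$ of index $2$, $J\leq H$, $l\in H$, and $r\in G\setminus H$. (a) The coloring associated with the partition $P=\{h(J\cup Jr):h\in H\}$ of $G$ is perfect if and only if $rJ=Jr$ (i.e. $r\in N_G(J)$) and $r^2\in J$. (b) The coloring associated with $P=\{h(J\cup Jr):h\in H\}$ is perfect if and only if the coloring associated with the partition $P^l(r^l)=\{h(J^l\cup J^lr^l):h\in H\}$ of $G$ is perfect, where $J^l=lJl^{ -1}$ and $r^l=lrl^{ -1}$.
   Context: $G$ acts on partitions of $G$ by left multiplication, $gP=\{gB:B\in P\}$. The coloring associated with a partition $P$ of $G$ is called perfect if $gP=P$ for all $g\in G$. -}

module Defs where

open import Level using (Level; _⊔_)
open import Algebra.Bundles using (Group)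
open import Data.Product using (Σ; Σ-syntax; _×_; ∃)
open import Data.Sum using (_⊎_)
open import Relation.Nullary using (¬_)
open import Relation.Unary using (Pred; _∈_; _∉_; _⊆_; _≐_; _∪_)

module GroupDefs {c ℓ : Level} (G : Group c ℓ) where
  open Group G public

  record IsSubgroup {p : Level} (S : Pred Carrier p) : Set (c ⊔ ℓ ⊔ p) where
    field
      resp  : ∀ {x y} → x ≈ y → S x → S y
      ε∈    : S ε
      ∙-cl  : ∀ {x y} → S x → S y → S (x ∙ y)
      ⁻¹-cl : ∀ {x} → S x → S (x ⁻¹)

  -- H has index 2 in G: there is a ∉ H such that G = H ∪ aH
  -- (exactly two left cosets H and aH).
  IndexTwo : {p : Level} → Pred Carrier p → Set (c ⊔ p)
  IndexTwo H = Σ[ a ∈ Carrier ] (a ∉ H × (∀ g → g ∈ H ⊎ (a ⁻¹ ∙ g) ∈ H))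

  _·ˡ_ : {p : Level} → Carrier → Pred Carrier p → Pred Carrier (c ⊔ ℓ ⊔ p)
  (g ·ˡ S) x = Σ[ s ∈ Carrier ] (S s × x ≈ g ∙ s)

  _·ʳ_ : {p : Level} → Pred Carrier p → Carrier → Pred Carrier (c ⊔ ℓ ⊔ p)
  (S ·ʳ g) x = Σ[ s ∈ Carrier ] (S s × x ≈ s ∙ g)

  Conj : {p : Level} → Carrier → Pred Carrier p → Pred Carrier (c ⊔ ℓ ⊔ p)
  Conj l S x = Σ[ s ∈ Carrier ] (S s × x ≈ (l ∙ s) ∙ l ⁻¹)

  Block : {p : Level} → Pred Carrier p → Carrier → Carrier → Pred Carrier (c ⊔ ℓ ⊔ p)
  Block J r h = h ·ˡ (J ∪ (J ·ʳ r))

  -- The coloring associated with P = {h(J ∪ Jr) : h ∈ H} is perfect: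
  -- gP = P (as sets of subsets of G) for every g ∈ G.
  Perfect : {p q : Level} → Pred Carrier p → Pred Carrier q → Carrier → Set (c ⊔ ℓ ⊔ p ⊔ q)
  Perfect H J r = ∀ g →
      (∀ h → h ∈ H → Σ[ h' ∈ Carrier ] (h' ∈ H × (g ·ˡ Block J r h) ≐ Block J r h'))
    × (∀ h' → h' ∈ H → Σ[ h ∈ Carrier ] (h ∈ H × (g ·ˡ Block J r h) ≐ Block J r h'))

-- Write B = J ∪ Jr, so that P = {hB : h ∈ H}. As G = H ∪ Hr, every translate gB is hB or
-- h(rB) with h ∈ H, so P is G-invariant iff rB ∈ P; and since r ∈ rB, that block can only
-- be B itself. Comparing the parts of rB = rJ ∪ rJr and B = J ∪ Jr outside and inside H
-- turns rB = B into rJ = Jr and r² ∈ J. Conjugation by l ∈ H preserves H and transports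
-- both conditions.
module Submission where

open import Defs
open import Level using (Level; _⊔_)
open import Algebra.Bundles using (Group)
open import Data.Product using (_×_; _,_; proj₁; proj₂; Σ-syntax)
open import Data.Sum using (_⊎_; inj₁; inj₂)
open import Data.Empty using (⊥-elim)
open import Function.Base using (_∘_)
open import Function.Bundles using (_⇔_; mk⇔)
open import Function.Properties.Equivalence using () renaming (sym to ⇔-sym; trans to ⇔-trans)
open import Relation.Binary.Definitions using (_Respects_)
open import Relation.Unary using (Pred; _∈_; _∉_; _⊆_; _≐_; _∪_)
open import Relation.Unary.Properties using (≐-refl; ≐-sym; ≐-trans)

module PerfectColourings {c ℓ : Level} (G : Group c ℓ) where
  open GroupDefs G public
  open import Algebra.Properties.Group G
    using (\\-leftDividesˡ; \\-leftDividesʳ; //-rightDividesʳ; ∙-cancelˡ; ∙-cancelʳ;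
           inverseˡ-unique; inverseʳ-unique; ⁻¹-involutive)
  open import Relation.Binary.Reasoning.Setoid setoid

  private variable
    p q : Level
    S : Pred Carrier p
    T : Pred Carrier q
    g g′ l x : Carrier

  module SubgroupProperties {S : Pred Carrier p} (S≤G : IsSubgroup S) where
    open IsSubgroup S≤G public

    ∈-cancelʳ : ∀ {x y} → x ∙ y ∈ S → y ∈ S → x ∈ S
    ∈-cancelʳ {x} {y} xy∈S y∈S = resp (//-rightDividesʳ y x) (∙-cl xy∈S (⁻¹-cl y∈S))

    ∈-cancelˡ : ∀ {x y} → x ∙ y ∈ S → x ∈ S → y ∈ S
    ∈-cancelˡ {x} {y} xy∈S x∈S = resp (\\-leftDividesʳ x y) (∙-cl (⁻¹-cl x∈S) xy∈S)

    ⁻¹∈⇒∈ : ∀ {x} → x ⁻¹ ∈ S → x ∈ S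
    ⁻¹∈⇒∈ x⁻¹∈S = resp (⁻¹-involutive _) (⁻¹-cl x⁻¹∈S)

    ∉∙∈⇒∉ : ∀ {x y} → x ∉ S → y ∈ S → x ∙ y ∉ S
    ∉∙∈⇒∉ x∉S y∈S xy∈S = x∉S (∈-cancelʳ xy∈S y∈S)

    ∈∙∉⇒∉ : ∀ {x y} → x ∈ S → y ∉ S → x ∙ y ∉ S
    ∈∙∉⇒∉ x∈S y∉S xy∈S = y∉S (∈-cancelˡ xy∈S x∈S)

  module IndexTwoProperties {H : Pred Carrier p} (H≤G : IsSubgroup H) (index : IndexTwo H) where
    open SubgroupProperties H≤G
    private
      a = proj₁ index
      a∉H = proj₁ (proj₂ index)
      cosets = proj₂ (proj₂ index)

    ∈⊎∉ : ∀ x → x ∈ H ⊎ x ∉ H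
    ∈⊎∉ x with cosets x
    ... | inj₁ x∈H = inj₁ x∈H
    ... | inj₂ a⁻¹x∈H = inj₂ (λ x∈H → a∉H (⁻¹∈⇒∈ (∈-cancelʳ a⁻¹x∈H x∈H)))

    ∉∙∉⇒∈ : ∀ {x y} → x ∉ H → y ∉ H → x ∙ y ∈ H
    ∉∙∉⇒∈ {x} {y} x∉H y∉H with cosets (x ∙ y) | cosets x
    ... | inj₁ xy∈H  | _           = xy∈H
    ... | inj₂ _     | inj₁ x∈H    = ⊥-elim (x∉H x∈H)
    ... | inj₂ a⁻¹xy | inj₂ a⁻¹x∈H =
      ⊥-elim (y∉H (∈-cancelˡ (resp (sym (assoc (a ⁻¹) x y)) a⁻¹xy) a⁻¹x∈H))

  ·ˡ-resp : (g ·ˡ S) Respects _≈_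
  ·ˡ-resp x≈y (s , s∈S , x≈gs) = s , s∈S , trans (sym x≈y) x≈gs

  ·ʳ-resp : (S ·ʳ g) Respects _≈_
  ·ʳ-resp x≈y (s , s∈S , x≈sg) = s , s∈S , trans (sym x≈y) x≈sg

  ·ˡ-assoc : ∀ g h (S : Pred Carrier p) → g ·ˡ (h ·ˡ S) ≐ (g ∙ h) ·ˡ S
  ·ˡ-assoc g h S = to , from
    where
    to : g ·ˡ (h ·ˡ S) ⊆ (g ∙ h) ·ˡ S
    to (_ , (s , s∈S , y≈hs) , x≈gy) = s , s∈S , trans x≈gy (trans (∙-congˡ y≈hs) (sym (assoc g h s)))
    from : (g ∙ h) ·ˡ S ⊆ g ·ˡ (h ·ˡ S)
    from (s , s∈S , x≈ghs) = h ∙ s , (s , s∈S , refl) , trans x≈ghs (assoc g h s)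

  ·ˡ-mono : S ⊆ T → g ·ˡ S ⊆ g ·ˡ T
  ·ˡ-mono S⊆T (s , s∈S , x≈gs) = s , S⊆T s∈S , x≈gs

  ·ʳ-mono : S ⊆ T → S ·ʳ g ⊆ T ·ʳ g
  ·ʳ-mono S⊆T (s , s∈S , x≈sg) = s , S⊆T s∈S , x≈sg

  ·ˡ-congˡ : ∀ g → S ≐ T → g ·ˡ S ≐ g ·ˡ T
  ·ˡ-congˡ g (S⊆T , T⊆S) = ·ˡ-mono S⊆T , ·ˡ-mono T⊆S

  ·ˡ-congʳ : g ≈ g′ → g ·ˡ S ≐ g′ ·ˡ S
  ·ˡ-congʳ g≈g′ = (λ (s , s∈S , x≈gs) → s , s∈S , trans x≈gs (∙-congʳ g≈g′))
                , (λ (s , s∈S , x≈g′s) → s , s∈S , trans x≈g′s (∙-congʳ (sym g≈g′)))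

  ·ˡ-absorb : {J : Pred Carrier q} → IsSubgroup J → S Respects _≈_ →
              (∀ {j s} → j ∈ J → s ∈ S → j ∙ s ∈ S) → ∀ {j} → j ∈ J → j ·ˡ S ≐ S
  ·ˡ-absorb J≤G S-resp J∙S⊆S {j} j∈J =
      (λ (s , s∈S , x≈js) → S-resp (sym x≈js) (J∙S⊆S j∈J s∈S))
    , (λ {x} x∈S → j ⁻¹ ∙ x , J∙S⊆S (IsSubgroup.⁻¹-cl J≤G j∈J) x∈S , sym (\\-leftDividesˡ j x))

  BaseBlock : Pred Carrier p → Carrier → Pred Carrier (c ⊔ ℓ ⊔ p)
  BaseBlock J r = J ∪ (J ·ʳ r)

  Block-absorb : {J : Pred Carrier p} → IsSubgroup J → ∀ {r j} → j ∈ J → Block J r j ≐ BaseBlock J r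
  Block-absorb {J = J} J≤G {r} = ·ˡ-absorb J≤G B-resp J∙B⊆B
    where
    open IsSubgroup J≤G
    B-resp : BaseBlock J r Respects _≈_
    B-resp x≈y (inj₁ x∈J)  = inj₁ (resp x≈y x∈J)
    B-resp x≈y (inj₂ x∈Jr) = inj₂ (·ʳ-resp x≈y x∈Jr)
    J∙B⊆B : ∀ {j s} → j ∈ J → s ∈ BaseBlock J r → j ∙ s ∈ BaseBlock J r
    J∙B⊆B j∈J (inj₁ s∈J) = inj₁ (∙-cl j∈J s∈J)
    J∙B⊆B {j} j∈J (inj₂ (j′ , j′∈J , s≈j′r)) =
      inj₂ (j ∙ j′ , ∙-cl j∈J j′∈J , trans (∙-congˡ s≈j′r) (sym (assoc j j′ r)))

  FixedBy : Carrier → Pred Carrier p → Set (c ⊔ ℓ ⊔ p)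
  FixedBy g S = g ·ˡ S ≐ S

  PerfectCriterion : Pred Carrier p → Carrier → Set (c ⊔ ℓ ⊔ p)
  PerfectCriterion J r = (r ·ˡ J ≐ J ·ʳ r) × r ∙ r ∈ J

  module _ {H : Pred Carrier p} {J : Pred Carrier q} (H≤G : IsSubgroup H) (J≤G : IsSubgroup J)
           (J⊆H : J ⊆ H) {r : Carrier} (r∉H : r ∉ H) where
    private
      module H = SubgroupProperties H≤G
      module J = SubgroupProperties J≤G
      B = BaseBlock J r

    r∈Block⇒∈J : ∀ {h} → h ∈ H → r ∈ Block J r h → h ∈ J
    r∈Block⇒∈J h∈H (b , inj₁ b∈J , r≈hb) =
      ⊥-elim (r∉H (H.resp (sym r≈hb) (H.∙-cl h∈H (J⊆H b∈J))))
    r∈Block⇒∈J {h} h∈H (b , inj₂ (j , j∈J , b≈jr) , r≈hb) =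
      J.resp (sym (inverseˡ-unique h j hj≈ε)) (J.⁻¹-cl j∈J)
      where
      hj≈ε : h ∙ j ≈ ε
      hj≈ε = ∙-cancelʳ r (h ∙ j) ε (begin
        (h ∙ j) ∙ r  ≈⟨ assoc h j r ⟩
        h ∙ (j ∙ r)  ≈⟨ ∙-congˡ b≈jr ⟨
        h ∙ b        ≈⟨ r≈hb ⟨
        r            ≈⟨ identityˡ r ⟨
        ε ∙ r        ∎)

    perfect⇒fixed : Perfect H J r → FixedBy r B
    perfect⇒fixed perfect with proj₁ (perfect r) ε H.ε∈
    ... | h , h∈H , rεB≐hB = ≐-trans rB≐hB (Block-absorb J≤G (r∈Block⇒∈J h∈H r∈hB))
      where
      rB≐hB : r ·ˡ B ≐ Block J r h
      rB≐hB = ≐-trans (·ˡ-congˡ r (≐-sym (Block-absorb J≤G J.ε∈))) rεB≐hB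
      r∈hB : r ∈ Block J r h
      r∈hB = proj₁ rB≐hB (ε , inj₁ J.ε∈ , sym (identityʳ r))

    fixed⇒criterion : FixedBy r B → PerfectCriterion J r
    fixed⇒criterion (rB⊆B , B⊆rB) = (rJ⊆Jr , Jr⊆rJ) , r²∈J
      where
      rJ⊆Jr : r ·ˡ J ⊆ J ·ʳ r
      rJ⊆Jr (j , j∈J , x≈rj) with rB⊆B (j , inj₁ j∈J , x≈rj)
      ... | inj₁ x∈J  = ⊥-elim (H.∉∙∈⇒∉ r∉H (J⊆H j∈J) (H.resp x≈rj (J⊆H x∈J)))
      ... | inj₂ x∈Jr = x∈Jr
      r²∈J : r ∙ r ∈ J
      r²∈J with rB⊆B (r , inj₂ (ε , J.ε∈ , sym (identityˡ r)) , refl)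
      ... | inj₁ rr∈J = rr∈J
      ... | inj₂ (j , j∈J , rr≈jr) = ⊥-elim (r∉H (H.resp (sym (∙-cancelʳ r r j rr≈jr)) (J⊆H j∈J)))
      Jr⊆rJ : J ·ʳ r ⊆ r ·ˡ J
      Jr⊆rJ x∈Jr with B⊆rB (inj₂ x∈Jr)
      ... | b , inj₁ b∈J , x≈rb = b , b∈J , x≈rb
      Jr⊆rJ {x} (j , j∈J , x≈jr) | b , inj₂ (j′ , j′∈J , b≈j′r) , x≈rb =
        ⊥-elim (r∉H (H.∈-cancelʳ (H.resp j≈rj′ (J⊆H j∈J)) (J⊆H j′∈J)))
        where
        j≈rj′ : j ≈ r ∙ j′
        j≈rj′ = ∙-cancelʳ r j (r ∙ j′) (begin
          j ∙ r         ≈⟨ x≈jr ⟨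
          x             ≈⟨ x≈rb ⟩
          r ∙ b         ≈⟨ ∙-congˡ b≈j′r ⟩
          r ∙ (j′ ∙ r)  ≈⟨ assoc r j′ r ⟨
          (r ∙ j′) ∙ r  ∎)

    criterion⇒fixed : PerfectCriterion J r → FixedBy r B
    criterion⇒fixed ((rJ⊆Jr , _) , r²∈J) = rB⊆B , B⊆rB
      where
      rB⊆B : r ·ˡ B ⊆ B
      rB⊆B (j , inj₁ j∈J , x≈rj) = inj₂ (rJ⊆Jr (j , j∈J , x≈rj))
      rB⊆B {x} (b , inj₂ (j , j∈J , b≈jr) , x≈rb) with rJ⊆Jr (j , j∈J , refl)
      ... | j′ , j′∈J , rj≈j′r = inj₁ (J.resp (sym x≈j′r²) (J.∙-cl j′∈J r²∈J))
        where
        x≈j′r² : x ≈ j′ ∙ (r ∙ r)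
        x≈j′r² = begin
          x             ≈⟨ x≈rb ⟩
          r ∙ b         ≈⟨ ∙-congˡ b≈jr ⟩
          r ∙ (j ∙ r)   ≈⟨ assoc r j r ⟨
          (r ∙ j) ∙ r   ≈⟨ ∙-congʳ rj≈j′r ⟩
          (j′ ∙ r) ∙ r  ≈⟨ assoc j′ r r ⟩
          j′ ∙ (r ∙ r)  ∎
      -- B = r²B = r(rB) ⊆ rB.
      B⊆rB : B ⊆ r ·ˡ B
      B⊆rB = ·ˡ-mono rB⊆B ∘ proj₂ (·ˡ-assoc r r B) ∘ proj₂ (Block-absorb J≤G r²∈J)

    module _ (index : IndexTwo H) where
      open IndexTwoProperties H≤G index

      translate-is-block : FixedBy r B → ∀ g → Σ[ h ∈ Carrier ] (h ∈ H × g ·ˡ B ≐ Block J r h)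
      translate-is-block fixed g with ∈⊎∉ g
      ... | inj₁ g∈H = g , g∈H , ≐-refl
      ... | inj₂ g∉H = g ∙ r , ∉∙∉⇒∈ g∉H r∉H , ≐-trans (·ˡ-congˡ g (≐-sym fixed)) (·ˡ-assoc g r B)

      fixed⇒perfect : FixedBy r B → Perfect H J r
      fixed⇒perfect fixed g = image , preimage
        where
        image : ∀ h → h ∈ H → Σ[ h′ ∈ Carrier ] (h′ ∈ H × g ·ˡ Block J r h ≐ Block J r h′)
        image h _ with translate-is-block fixed (g ∙ h)
        ... | h′ , h′∈H , ghB≐h′B = h′ , h′∈H , ≐-trans (·ˡ-assoc g h B) ghB≐h′B
        preimage : ∀ h′ → h′ ∈ H → Σ[ h ∈ Carrier ] (h ∈ H × g ·ˡ Block J r h ≐ Block J r h′)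
        preimage h′ _ with translate-is-block fixed (g ⁻¹ ∙ h′)
        ... | h , h∈H , g⁻¹h′B≐hB = h , h∈H ,
          ≐-trans (·ˡ-congˡ g (≐-sym g⁻¹h′B≐hB))
                  (≐-trans (·ˡ-assoc g (g ⁻¹ ∙ h′) B) (·ˡ-congʳ (\\-leftDividesˡ g h′)))

      perfect⇔criterion : Perfect H J r ⇔ PerfectCriterion J r
      perfect⇔criterion = mk⇔ (fixed⇒criterion ∘ perfect⇒fixed) (fixed⇒perfect ∘ criterion⇒fixed)

  conj : Carrier → Carrier → Carrier
  conj l x = (l ∙ x) ∙ l ⁻¹

  conj-cong : ∀ {x y} → x ≈ y → conj l x ≈ conj l y
  conj-cong x≈y = ∙-congʳ (∙-congˡ x≈y)

  conj-homo : ∀ x y → conj l (x ∙ y) ≈ conj l x ∙ conj l y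
  conj-homo {l} x y = begin
    (l ∙ (x ∙ y)) ∙ l ⁻¹                 ≈⟨ ∙-congʳ (assoc l x y) ⟨
    ((l ∙ x) ∙ y) ∙ l ⁻¹                 ≈⟨ ∙-congʳ (∙-congˡ (\\-leftDividesʳ l y)) ⟨
    ((l ∙ x) ∙ (l ⁻¹ ∙ (l ∙ y))) ∙ l ⁻¹  ≈⟨ ∙-congʳ (assoc (l ∙ x) (l ⁻¹) (l ∙ y)) ⟨
    (conj l x ∙ (l ∙ y)) ∙ l ⁻¹          ≈⟨ assoc (conj l x) (l ∙ y) (l ⁻¹) ⟩
    conj l x ∙ conj l y                  ∎

  conj-injective : ∀ {x y} → conj l x ≈ conj l y → x ≈ y
  conj-injective {l} {x} {y} e = ∙-cancelˡ l x y (∙-cancelʳ (l ⁻¹) (l ∙ x) (l ∙ y) e)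

  conj-ε : conj l ε ≈ ε
  conj-ε {l} = trans (∙-congʳ (identityʳ l)) (inverseʳ l)

  conj-⁻¹ : ∀ x → conj l (x ⁻¹) ≈ conj l x ⁻¹
  conj-⁻¹ {l} x = inverseʳ-unique (conj l x) (conj l (x ⁻¹)) (begin
    conj l x ∙ conj l (x ⁻¹)  ≈⟨ conj-homo x (x ⁻¹) ⟨
    conj l (x ∙ x ⁻¹)         ≈⟨ conj-cong (inverseʳ x) ⟩
    conj l ε                  ≈⟨ conj-ε ⟩
    ε                         ∎)

  Conj-isSubgroup : {J : Pred Carrier p} → IsSubgroup J → IsSubgroup (Conj l J)
  Conj-isSubgroup {l = l} J≤G = record
    { resp  = λ x≈y (s , s∈J , x≈ls) → s , s∈J , trans (sym x≈y) x≈ls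
    ; ε∈    = ε , ε∈ , sym conj-ε
    ; ∙-cl  = λ (s , s∈J , x≈ls) (t , t∈J , y≈lt) →
                s ∙ t , ∙-cl s∈J t∈J , trans (∙-cong x≈ls y≈lt) (sym (conj-homo s t))
    ; ⁻¹-cl = λ (s , s∈J , x≈ls) → s ⁻¹ , ⁻¹-cl s∈J , trans (⁻¹-cong x≈ls) (sym (conj-⁻¹ s))
    }
    where open IsSubgroup J≤G

  Conj-mono : S ⊆ T → Conj l S ⊆ Conj l T
  Conj-mono S⊆T (s , s∈S , x≈ls) = s , S⊆T s∈S , x≈ls

  conj∈Conj⇒∈ : S Respects _≈_ → conj l x ∈ Conj l S → x ∈ S
  conj∈Conj⇒∈ S-resp (s , s∈S , lx≈ls) = S-resp (sym (conj-injective lx≈ls)) s∈S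

  Conj-reflect : T Respects _≈_ → Conj l S ⊆ Conj l T → S ⊆ T
  Conj-reflect T-resp lS⊆lT s∈S = conj∈Conj⇒∈ T-resp (lS⊆lT (_ , s∈S , refl))

  Conj-·ˡ : ∀ l g (S : Pred Carrier p) → Conj l (g ·ˡ S) ≐ conj l g ·ˡ Conj l S
  Conj-·ˡ l g S = to , from
    where
    to : Conj l (g ·ˡ S) ⊆ conj l g ·ˡ Conj l S
    to (y , (s , s∈S , y≈gs) , x≈ly) =
      conj l s , (s , s∈S , refl) , trans x≈ly (trans (conj-cong y≈gs) (conj-homo g s))
    from : conj l g ·ˡ Conj l S ⊆ Conj l (g ·ˡ S)
    from (y , (s , s∈S , y≈ls) , x≈lgy) =
      g ∙ s , (s , s∈S , refl) , trans x≈lgy (trans (∙-congˡ y≈ls) (sym (conj-homo g s)))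

  Conj-·ʳ : ∀ l g (S : Pred Carrier p) → Conj l (S ·ʳ g) ≐ Conj l S ·ʳ conj l g
  Conj-·ʳ l g S = to , from
    where
    to : Conj l (S ·ʳ g) ⊆ Conj l S ·ʳ conj l g
    to (y , (s , s∈S , y≈sg) , x≈ly) =
      conj l s , (s , s∈S , refl) , trans x≈ly (trans (conj-cong y≈sg) (conj-homo s g))
    from : Conj l S ·ʳ conj l g ⊆ Conj l (S ·ʳ g)
    from (y , (s , s∈S , y≈ls) , x≈ylg) =
      s ∙ g , (s , s∈S , refl) , trans x≈ylg (trans (∙-congʳ y≈ls) (sym (conj-homo s g)))

  criterion⇔Conj : {J : Pred Carrier p} → IsSubgroup J →
                   ∀ {r} → PerfectCriterion J r ⇔ PerfectCriterion (Conj l J) (conj l r)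
  criterion⇔Conj {l = l} {J = J} J≤G {r} = mk⇔ to from
    where
    to : PerfectCriterion J r → PerfectCriterion (Conj l J) (conj l r)
    to ((rJ⊆Jr , Jr⊆rJ) , r²∈J) =
        ( proj₁ (Conj-·ʳ l r J) ∘ Conj-mono rJ⊆Jr ∘ proj₂ (Conj-·ˡ l r J)
        , proj₁ (Conj-·ˡ l r J) ∘ Conj-mono Jr⊆rJ ∘ proj₂ (Conj-·ʳ l r J) )
      , (r ∙ r , r²∈J , sym (conj-homo r r))
    from : PerfectCriterion (Conj l J) (conj l r) → PerfectCriterion J r
    from ((rJ⊆Jr , Jr⊆rJ) , r²∈J) =
        ( Conj-reflect ·ʳ-resp (proj₂ (Conj-·ʳ l r J) ∘ rJ⊆Jr ∘ proj₁ (Conj-·ˡ l r J))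
        , Conj-reflect ·ˡ-resp (proj₂ (Conj-·ˡ l r J) ∘ Jr⊆rJ ∘ proj₁ (Conj-·ʳ l r J)) )
      , conj∈Conj⇒∈ (IsSubgroup.resp J≤G)
                    (IsSubgroup.resp (Conj-isSubgroup J≤G) (sym (conj-homo r r)) r²∈J)

  module _ {H : Pred Carrier p} (H≤G : IsSubgroup H) (l∈H : l ∈ H) where
    open SubgroupProperties H≤G

    Conj-⊆ : S ⊆ H → Conj l S ⊆ H
    Conj-⊆ S⊆H (s , s∈S , x≈ls) = resp (sym x≈ls) (∙-cl (∙-cl l∈H (S⊆H s∈S)) (⁻¹-cl l∈H))

    conj-∉ : x ∉ H → conj l x ∉ H
    conj-∉ x∉H = ∉∙∈⇒∉ (∈∙∉⇒∉ l∈H x∉H) (⁻¹-cl l∈H)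

theorem5 : {c ℓ p : Level} (G : Group c ℓ) → let open GroupDefs G in
    (H J : Pred Carrier p) → IsSubgroup H → IndexTwo H → IsSubgroup J → J ⊆ H →
    (l r : Carrier) → l ∈ H → r ∉ H →
    (Perfect H J r ⇔ ((r ·ˡ J) ≐ (J ·ʳ r) × (r ∙ r) ∈ J))
    × (Perfect H J r ⇔ Perfect H (Conj l J) ((l ∙ r) ∙ l ⁻¹))
theorem5 G H J H≤G index J≤G J⊆H l r l∈H r∉H =
  part-a , ⇔-trans part-a (⇔-trans (criterion⇔Conj J≤G) (⇔-sym part-a-conjugated))
  where
  open PerfectColourings G
  part-a : Perfect H J r ⇔ PerfectCriterion J r
  part-a = perfect⇔criterion H≤G J≤G J⊆H r∉H index
  part-a-conjugated : Perfect H (Conj l J) (conj l r) ⇔ PerfectCriterion (Conj l J) (conj l r)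
  part-a-conjugated = perfect⇔criterion H≤G (Conj-isSubgroup J≤G) (Conj-⊆ H≤G l∈H J⊆H)
                                        (conj-∉ H≤G l∈H r∉H) index
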